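{- Let $P_1$ and $P_2$ be LPODs. Then $P_1$ and $P_2$ are strongly equivalent under all the answer sets (that is, for every LPOD $P$, the programs $P_1\cup P$ and $P_2\cup P$ have the same answer sets) if and only if $P_1$ and $P_2$ are logically equivalent in the four-valued logic (that is, they have the same models).
   Context: Let $\Sigma$ be a nonempty, countably infinite set of propositional atoms. Formulas are built from atoms using the binary connectives $\wedge$, $\vee$, $\leftarrow$, $\times$ and the unary connective $\mathit{not}$. Truth values are $V=\{F,F^*,T^*,T\}$ ordered $F<F^*<T^*<T$. An interpretation is a function $I:\Sigma\to V$, extended to formulas by: $I(\mathit{not}\,\phi)=T$ if $I(\phi)\le F^*$ and $F$ otherwise; $I(\phi\leftarrow\psi)=T$ if $I(\phi)\ge I(\psi)$ and $F$ otherwise; $I(\phi_1\wedge\phi_2)=\min\{I(\phi_1),I(\phi_2)\}$; $I(\phi_1\vee\phi_2)=\max\{I(\phi_1),I(\phi_2)\}$; $I(\phi_1\times\phi_2)=I(\phi_2)$ if $I(\phi_1)=F^*$ and $I(\phi_1)$ otherwise (these are associative; a comma in a rule body denotes $\wedge$). An LPOD is a finite set of rules $C_1\times\cdots\times C_n\leftarrow A_1,\ldots,A_m,\mathit{not}\,B_1,\ldots,\mathit{not}\,B_k$ with $n\ge1$, $m,k\ge0$ and all $C_i,A_j,B_l$ atoms. An interpretation $I$ is a model of an LPOD $P$ if every rule of $P$ evaluates to $T$ under $I$; two LPODs are logically equivalent if they have the same models. Define the relation $\prec$ on truth values by $F\prec F^*$, $F\prec T^*$, $F\prec T$, $T^*\prec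 T$ (and no other pairs), with $v_1\preceq v_2$ iff $v_1\prec v_2$ or $v_1=v_2$. For interpretations $I_1,I_2$ of $P$, $I_1\preceq I_2$ iff $I_1(A)\preceq I_2(A)$ for all atoms $A$ in $P$, and $I_1\prec I_2$ iff $I_1\preceq I_2$ and $I_1\ne I_2$. An interpretation $I$ is solid if $I(A)\ne T^*$ for all atoms $A$ in $P$. An answer set of $P$ is a solid $\preceq$-minimal model of $P$. -}

module Defs where

open import Data.Nat using (ℕ; _≤ᵇ_)
open import Data.Bool using (Bool; true; false; if_then_else_)
open import Data.List using (List; []; _∷_; _++_)
open import Data.List.NonEmpty using (List⁺; _∷_)
open import Data.List.Relation.Unary.All using (All)
open import Relation.Binary.PropositionalEquality using (_≡_)
open import Relation.Nullary using (¬_)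
open import Data.Sum using (_⊎_)

Atom : Set
Atom = ℕ

data V : Set where
  F F* T* T : V

rank : V → ℕ
rank F = 0
rank F* = 1
rank T* = 2
rank T = 3

infix 4 _≤?V_
_≤?V_ : V → V → Bool
v ≤?V w = rank v ≤ᵇ rank w

minV : V → V → V
minV v w = if v ≤?V w then v else w

maxV : V → V → V
maxV v w = if v ≤?V w then w else v

data Formula : Set where
  atom : Atom → Formula
  _∧_ _∨_ _⇐_ _×ᶠ_ : Formula → Formula → Formula
  not : Formula → Formula

Interpretation : Set
Interpretation = Atom → V

eval : Formula → Interpretation → V
eval (atom a) I = I a
eval (φ ∧ ψ) I = minV (eval (φ) I) (eval (ψ) I)
eval (φ ∨ ψ) I = maxV (eval (φ) I) (eval (ψ) I)
eval (φ ⇐ ψ) I = if eval (ψ) I ≤?V eval (φ) I then T else F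
eval (φ ×ᶠ ψ) I with eval (φ) I
... | F* = eval (ψ) I
... | v = v
eval (not φ) I = if eval (φ) I ≤?V F* then T else F

-- LPOD rule  C₁ × ⋯ × Cₙ ← A₁,…,Aₘ, not B₁,…, not Bₖ
record Rule : Set where
  constructor rule
  field
    head : List⁺ Atom
    pos  : List Atom
    neg  : List Atom

LPOD : Set
LPOD = List Rule

headFrom : Atom → List Atom → Formula
headFrom c [] = atom c
headFrom c (d ∷ ds) = atom c ×ᶠ headFrom d ds

headFormula : List⁺ Atom → Formula
headFormula (c ∷ cs) = headFrom c cs

bodyLits : List Atom → List Atom → List Formula
bodyLits [] ns = Data.List.map (λ b → not (atom b)) ns
bodyLits (a ∷ as) ns = atom a ∷ bodyLits as ns

bodyVal : List Formula → Interpretation → V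
bodyVal [] I = T
bodyVal (φ ∷ ψs) I = minV (eval φ I) (bodyVal ψs I)

ruleVal : Rule → Interpretation → V
ruleVal (rule h p n) I =
  if bodyVal (bodyLits p n) I ≤?V eval (headFormula h) I then T else F

Model : LPOD → Interpretation → Set
Model P I = All (λ r → ruleVal r I ≡ T) P

LogicallyEquivalent : LPOD → LPOD → Set
LogicallyEquivalent P₁ P₂ = ∀ I → (Model P₁ I → Model P₂ I) Data.Product.× (Model P₂ I → Model P₁ I)
  where import Data.Product

data _≺V_ : V → V → Set where
  F≺F*  : F ≺V F*
  F≺T*  : F ≺V T*
  F≺T   : F ≺V T
  T*≺T  : T* ≺V T

_⪯V_ : V → V → Set
v ⪯V w = (v ≺V w) ⊎ (v ≡ w)

_⪯_ : Interpretation → Interpretation → Set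
I₁ ⪯ I₂ = ∀ a → I₁ a ⪯V I₂ a

Solid : Interpretation → Set
Solid I = ∀ a → ¬ (I a ≡ T*)

AnswerSet : LPOD → Interpretation → Set
AnswerSet P I =
  Model P I Data.Product.×
  (Solid I Data.Product.×
   (∀ J → Model P J → J ⪯ I → ∀ a → J a ≡ I a))
  where import Data.Product

StronglyEquivalent : LPOD → LPOD → Set
StronglyEquivalent P₁ P₂ = ∀ (P : LPOD) (I : Interpretation) →
  (AnswerSet (P₁ ++ P) I → AnswerSet (P₂ ++ P) I) Data.Product.×
  (AnswerSet (P₂ ++ P) I → AnswerSet (P₁ ++ P) I)
  where import Data.Product

-- Logical equivalence gives strong equivalence since answer sets of P₁ ∪ P are defined from
-- models of P₁ ∪ P alone.  Conversely let I ⊨ P₁.  As ⪯ compares interpretations on all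
-- atoms, first restrict I to the atoms of P₁ and P₂, making a fresh atom t true and all other
-- atoms false; call the result N, and let M be N with every T* raised to T.  The program
-- encoding N pins every atom of an interpretation below M to its N-value, except those with
-- value T*, which must be all T* or all T: its models below M are exactly N and M.  Raising
-- preserves models, so the solid M is an answer set of P₁ ∪ encoding M, hence of
-- P₂ ∪ encoding M, and M ⊨ P₂.  If N ⊭ P₂, then M is an answer set of P₂ ∪ encoding N,
-- hence of P₁ ∪ encoding N, which has the model N ⪯ M; so N = M ⊨ P₂ after all.

module Submission where

open import Defs
open import Data.Product using (_×_; _,_; proj₁; proj₂)
open import Data.Sum using (_⊎_; inj₁; inj₂; map₂)
open import Data.Empty using (⊥-elim)
open import Function using (_∘_; id)
open import Data.Nat using (suc) renaming (_≟_ to _≟ℕ_)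
open import Data.Nat.Properties using (1+n≰n)
open import Data.Bool using (if_then_else_)
open import Data.List using (List; []; _∷_; _++_; map; concatMap; filter; cartesianProductWith)
open import Data.List.NonEmpty using (_∷_; toList)
open import Data.List.Extrema.Nat using (max; xs≤max)
open import Data.List.Relation.Unary.All as All using (All; []; _∷_; all?; lookup; tabulate)
open import Data.List.Relation.Unary.All.Properties using (++⁺; ++⁻ˡ; ++⁻ʳ; map⁺; cartesianProductWith⁺)
open import Data.List.Relation.Unary.Any using (here; there; any?)
open import Data.List.Membership.Propositional using (_∈_; _∉_; find; lose)
open import Data.List.Membership.Propositional.Properties
  using (∈-++⁺ˡ; ∈-++⁺ʳ; ∈-map⁺; ∈-filter⁺; ∈-filter⁻; ∈-cartesianProductWith⁺)
open import Data.List.Membership.DecPropositional _≟ℕ_ using (_∈?_)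
open import Relation.Nullary using (¬_; Dec; yes; no; contradiction)
open import Relation.Binary.PropositionalEquality
  using (_≡_; _≢_; _≗_; refl; sym; trans; cong; cong₂; subst; setoid; module ≡-Reasoning)

_≟V_ : (v w : V) → Dec (v ≡ w)
F  ≟V F  = yes refl
F  ≟V F* = no λ ()
F  ≟V T* = no λ ()
F  ≟V T  = no λ ()
F* ≟V F  = no λ ()
F* ≟V F* = yes refl
F* ≟V T* = no λ ()
F* ≟V T  = no λ ()
T* ≟V F  = no λ ()
T* ≟V F* = no λ ()
T* ≟V T* = yes refl
T* ≟V T  = no λ ()
T  ≟V F  = no λ ()
T  ≟V F* = no λ ()
T  ≟V T* = no λ ()
T  ≟V T  = yes refl

_≟T : (v : V) → Dec (v ≡ T)
v ≟T = v ≟V T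

infixr 6 _×V_
_×V_ : V → V → V
F* ×V w = w
v  ×V w = v

notV : V → V
notV v = if v ≤?V F* then T else F

infix 4 _⇐V_
_⇐V_ : V → V → V
h ⇐V b = if b ≤?V h then T else F

eval-×ᶠ : ∀ φ ψ I → eval (φ ×ᶠ ψ) I ≡ eval φ I ×V eval ψ I
eval-×ᶠ φ ψ I with eval φ I
... | F  = refl
... | F* = refl
... | T* = refl
... | T  = refl

headVal : Rule → Interpretation → V
headVal r = eval (headFormula (Rule.head r))

bodyValᴿ : Rule → Interpretation → V
bodyValᴿ r = bodyVal (bodyLits (Rule.pos r) (Rule.neg r))

atomsᴿ : Rule → List Atom
atomsᴿ (rule h p n) = toList h ++ p ++ n

atomsᴾ : LPOD → List Atom
atomsᴾ = concatMap atomsᴿ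

record IsHomomorphism (f : V → V) : Set where
  field
    preserves-T   : f T ≡ T
    preserves-min : ∀ v w → f (minV v w) ≡ minV (f v) (f w)
    preserves-×   : ∀ v w → f (v ×V w) ≡ f v ×V f w
    preserves-not : ∀ v → f (notV v) ≡ notV (f v)

module _ {f : V → V} (hom : IsHomomorphism f) {I J : Interpretation} where
  open IsHomomorphism hom

  Related : List Atom → Set
  Related as = ∀ {a} → a ∈ as → J a ≡ f (I a)

  headFrom-hom : ∀ c cs → Related (c ∷ cs) →
                 eval (headFrom c cs) J ≡ f (eval (headFrom c cs) I)
  headFrom-hom c []       rel = rel (here refl)
  headFrom-hom c (d ∷ ds) rel = begin
    eval (atom c ×ᶠ headFrom d ds) J        ≡⟨ eval-×ᶠ (atom c) (headFrom d ds) J ⟩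
    J c ×V eval (headFrom d ds) J           ≡⟨ cong₂ _×V_ (rel (here refl)) (headFrom-hom d ds (rel ∘ there)) ⟩
    f (I c) ×V f (eval (headFrom d ds) I)   ≡⟨ preserves-× (I c) _ ⟨
    f (I c ×V eval (headFrom d ds) I)       ≡⟨ cong f (eval-×ᶠ (atom c) (headFrom d ds) I) ⟨
    f (eval (atom c ×ᶠ headFrom d ds) I)    ∎
    where open ≡-Reasoning

  bodyVal-hom : ∀ φs → All (λ φ → eval φ J ≡ f (eval φ I)) φs →
                bodyVal φs J ≡ f (bodyVal φs I)
  bodyVal-hom []       []       = sym preserves-T
  bodyVal-hom (φ ∷ φs) (e ∷ es) =
    trans (cong₂ minV e (bodyVal-hom φs es)) (sym (preserves-min _ _))

  bodyLits-hom : ∀ p n → Related (p ++ n) →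
                 All (λ φ → eval φ J ≡ f (eval φ I)) (bodyLits p n)
  bodyLits-hom []      n rel = map⁺ (tabulate λ b∈n →
    trans (cong notV (rel b∈n)) (sym (preserves-not _)))
  bodyLits-hom (a ∷ p) n rel = rel (here refl) ∷ bodyLits-hom p n (rel ∘ there)

  ruleVal-hom : ∀ r → Related (atomsᴿ r) →
                ruleVal r J ≡ (f (headVal r I) ⇐V f (bodyValᴿ r I))
  ruleVal-hom (rule (c ∷ cs) p n) rel =
    cong₂ _⇐V_ (headFrom-hom c cs (rel ∘ ∈-++⁺ˡ))
               (bodyVal-hom _ (bodyLits-hom p n (rel ∘ ∈-++⁺ʳ (c ∷ cs))))

id-isHomomorphism : IsHomomorphism id
id-isHomomorphism = record
  { preserves-T = refl ; preserves-min = λ _ _ → refl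
  ; preserves-× = λ _ _ → refl ; preserves-not = λ _ → refl }

Model-cong : ∀ {I J} P → (∀ {a} → a ∈ atomsᴾ P → I a ≡ J a) → Model P I → Model P J
Model-cong []      agree []          = []
Model-cong (r ∷ P) agree (r⊨ ∷ P⊨) =
  trans (ruleVal-hom id-isHomomorphism r (sym ∘ agree ∘ ∈-++⁺ˡ)) r⊨
  ∷ Model-cong P (agree ∘ ∈-++⁺ʳ (atomsᴿ r)) P⊨

Model? : ∀ P I → Dec (Model P I)
Model? P I = all? (λ r → ruleVal r I ≟T) P

Model-++ˡ : ∀ {P₁ P₂ I} P → (Model P₁ I → Model P₂ I) → Model (P₁ ++ P) I → Model (P₂ ++ P) I
Model-++ˡ {P₁} P sub P₁P⊨ = ++⁺ (sub (++⁻ˡ P₁ P₁P⊨)) (++⁻ʳ P₁ P₁P⊨)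

raise : V → V
raise T* = T
raise v  = v

raise-min : ∀ v w → raise (minV v w) ≡ minV (raise v) (raise w)
raise-min F  w  = refl
raise-min F* F  = refl
raise-min F* F* = refl
raise-min F* T* = refl
raise-min F* T  = refl
raise-min T* F  = refl
raise-min T* F* = refl
raise-min T* T* = refl
raise-min T* T  = refl
raise-min T  F  = refl
raise-min T  F* = refl
raise-min T  T* = refl
raise-min T  T  = refl

raise-× : ∀ v w → raise (v ×V w) ≡ raise v ×V raise w
raise-× F  w = refl
raise-× F* w = refl
raise-× T* w = refl
raise-× T  w = refl

raise-not : ∀ v → raise (notV v) ≡ notV (raise v)
raise-not F  = refl
raise-not F* = refl
raise-not T* = refl
raise-not T  = refl

raise-isHomomorphism : IsHomomorphism raise
raise-isHomomorphism = record
  { preserves-T = refl ; preserves-min = raise-min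
  ; preserves-× = raise-× ; preserves-not = raise-not }

raise-⇐V : ∀ h b → (h ⇐V b) ≡ T → (raise h ⇐V raise b) ≡ T
raise-⇐V F  F  _ = refl
raise-⇐V F* F  _ = refl
raise-⇐V F* F* _ = refl
raise-⇐V T* F  _ = refl
raise-⇐V T* F* _ = refl
raise-⇐V T* T* _ = refl
raise-⇐V T  F  _ = refl
raise-⇐V T  F* _ = refl
raise-⇐V T  T* _ = refl
raise-⇐V T  T  _ = refl
raise-⇐V F  F* ()
raise-⇐V F  T* ()
raise-⇐V F  T  ()
raise-⇐V F* T* ()
raise-⇐V F* T  ()
raise-⇐V T* T  ()

Model-raise : ∀ {P I} → Model P I → Model P (raise ∘ I)
Model-raise {I = I} = All.map λ {r} r⊨ →
  trans (ruleVal-hom raise-isHomomorphism r (λ _ → refl)) (raise-⇐V (headVal r I) (bodyValᴿ r I) r⊨)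

raise-solid : ∀ v → raise v ≢ T*
raise-solid F  ()
raise-solid F* ()
raise-solid T* ()
raise-solid T  ()

raise-≢T* : ∀ {v} → v ≢ T* → raise v ≡ v
raise-≢T* {F}  _ = refl
raise-≢T* {F*} _ = refl
raise-≢T* {T*} v≢T* = ⊥-elim (v≢T* refl)
raise-≢T* {T}  _ = refl

⪯V-raise : ∀ v → v ⪯V raise v
⪯V-raise F  = inj₂ refl
⪯V-raise F* = inj₂ refl
⪯V-raise T* = inj₁ T*≺T
⪯V-raise T  = inj₂ refl

⪯V-F : ∀ {v} → v ⪯V F → v ≡ F
⪯V-F (inj₂ v≡F) = v≡F

⪯V-F* : ∀ {v} → v ⪯V F* → v ≢ F → v ≡ F*
⪯V-F* (inj₁ F≺F*) v≢F = ⊥-elim (v≢F refl)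
⪯V-F* (inj₂ v≡F*) _   = v≡F*

fact : Atom → Rule
fact a = rule (a ∷ []) [] []

preferFact : Atom → Atom → Rule
preferFact a b = rule (a ∷ b ∷ []) [] []

forceAboveF* : Atom → Rule
forceAboveF* a = rule (a ∷ []) [] (a ∷ [])

implication : Atom → Atom → Rule
implication a b = rule (a ∷ []) (b ∷ []) []

module _ (J : Interpretation) where

  fact-sound : ∀ a → ruleVal (fact a) J ≡ T → J a ≡ T
  fact-sound a with J a
  ... | F  = λ ()
  ... | F* = λ ()
  ... | T* = λ ()
  ... | T  = λ _ → refl

  fact-complete : ∀ a → J a ≡ T → ruleVal (fact a) J ≡ T
  fact-complete a Ja≡T = cong (_⇐V T) Ja≡T

  preferFact-sound : ∀ a b → ruleVal (preferFact a b) J ≡ T → J a ≢ F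
  preferFact-sound a b with J a
  ... | F  = λ ()
  ... | F* = λ _ ()
  ... | T* = λ _ ()
  ... | T  = λ _ ()

  preferFact-complete : ∀ a b → J a ≡ F* → J b ≡ T → ruleVal (preferFact a b) J ≡ T
  preferFact-complete a b Ja≡F* Jb≡T rewrite Ja≡F* | Jb≡T = refl

  forceAboveF*-sound : ∀ a → ruleVal (forceAboveF* a) J ≡ T → J a ≡ T* ⊎ J a ≡ T
  forceAboveF*-sound a with J a
  ... | F  = λ ()
  ... | F* = λ ()
  ... | T* = λ _ → inj₁ refl
  ... | T  = λ _ → inj₂ refl

  forceAboveF*-complete : ∀ a → J a ≡ T* → ruleVal (forceAboveF* a) J ≡ T
  forceAboveF*-complete a Ja≡T* rewrite Ja≡T* = refl

  implication-sound : ∀ a b → ruleVal (implication a b) J ≡ T → J b ≡ T → J a ≡ T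
  implication-sound a b holds Jb≡T rewrite Jb≡T = fact-sound a holds

  implication-complete : ∀ a b → J a ≡ J b → ruleVal (implication a b) J ≡ T
  implication-complete a b Ja≡Jb rewrite Ja≡Jb with J b
  ... | F  = refl
  ... | F* = refl
  ... | T* = refl
  ... | T  = refl

Supported : List Atom → Atom → Interpretation → Set
Supported A t N = N t ≡ T × (∀ a → a ∈ A ⊎ a ≡ t ⊎ N a ≡ F)

Supported-raise : ∀ {A t N} → Supported A t N → Supported A t (raise ∘ N)
Supported-raise (Nt≡T , classify) = cong raise Nt≡T , map₂ (map₂ (cong raise)) ∘ classify

module Encoding (A : List Atom) (t : Atom) where

  module _ (N : Interpretation) where

    withValue : V → List Atom
    withValue v = filter (λ a → N a ≟V v) A

    value : ∀ {a v} → a ∈ withValue v → N a ≡ v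
    value {v = v} = proj₂ ∘ ∈-filter⁻ (λ a → N a ≟V v) {xs = A}

    encoding : LPOD
    encoding = fact t
      ∷ map fact (withValue T)
      ++ map (λ a → preferFact a t) (withValue F*)
      ++ map forceAboveF* (withValue T*)
      ++ cartesianProductWith implication (withValue T*) (withValue T*)

    fact∈ : ∀ {a} → a ∈ withValue T → fact a ∈ encoding
    fact∈ = there ∘ ∈-++⁺ˡ ∘ ∈-map⁺ fact

    preferFact∈ : ∀ {a} → a ∈ withValue F* → preferFact a t ∈ encoding
    preferFact∈ = there ∘ ∈-++⁺ʳ (map fact (withValue T)) ∘ ∈-++⁺ˡ ∘ ∈-map⁺ (λ b → preferFact b t)

    forceAboveF*∈ : ∀ {a} → a ∈ withValue T* → forceAboveF* a ∈ encoding
    forceAboveF*∈ = there ∘ ∈-++⁺ʳ (map fact (withValue T))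
      ∘ ∈-++⁺ʳ (map (λ b → preferFact b t) (withValue F*)) ∘ ∈-++⁺ˡ ∘ ∈-map⁺ forceAboveF*

    implication∈ : ∀ {a b} → a ∈ withValue T* → b ∈ withValue T* → implication a b ∈ encoding
    implication∈ a∈ b∈ = there (∈-++⁺ʳ (map fact (withValue T))
      (∈-++⁺ʳ (map (λ b → preferFact b t) (withValue F*))
      (∈-++⁺ʳ (map forceAboveF* (withValue T*)) (∈-cartesianProductWith⁺ implication a∈ b∈))))

    encoding-model : N t ≡ T → Model encoding N
    encoding-model Nt≡T = fact-complete N t Nt≡T
      ∷ ++⁺ (map⁺ (tabulate λ {a} a∈ → fact-complete N a (value a∈)))
        (++⁺ (map⁺ (tabulate λ {a} a∈ → preferFact-complete N a t (value a∈) Nt≡T))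
        (++⁺ (map⁺ (tabulate λ {a} a∈ → forceAboveF*-complete N a (value a∈)))
        (cartesianProductWith⁺ (setoid Atom) (setoid Atom) implication _ _
           λ {a} {b} a∈ b∈ → implication-complete N a b (trans (value a∈) (sym (value b∈))))))

    module Minimal (supported : Supported A t N) {J : Interpretation}
                   (J⊨ : Model encoding J) (J⪯ : J ⪯ (raise ∘ N)) where

      holds : ∀ {r} → r ∈ encoding → ruleVal r J ≡ T
      holds = lookup J⊨

      J-t : J t ≡ T
      J-t = fact-sound J t (holds (here refl))

      member : ∀ {a v} → a ∈ A → N a ≡ v → a ∈ withValue v
      member {v = v} = ∈-filter⁺ (λ b → N b ≟V v)

      pinned : ∀ {a} → N a ≢ T* → J a ≡ N a
      pinned {a} Na≢T* with proj₂ supported a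
      ... | inj₂ (inj₁ refl) = trans J-t (sym (proj₁ supported))
      ... | inj₂ (inj₂ Na≡F) =
        trans (⪯V-F (subst (λ v → J a ⪯V raise v) Na≡F (J⪯ a))) (sym Na≡F)
      ... | inj₁ a∈A with N a in eq | J⪯ a
      ...   | F  | Ja⪯ = ⪯V-F Ja⪯
      ...   | F* | Ja⪯ = ⪯V-F* Ja⪯ (preferFact-sound J a t (holds (preferFact∈ (member a∈A eq))))
      ...   | T* | _   = ⊥-elim (Na≢T* refl)
      ...   | T  | _   = fact-sound J a (holds (fact∈ (member a∈A eq)))

      starred : ∀ {a} → N a ≡ T* → a ∈ withValue T*
      starred {a} Na≡T* with proj₂ supported a
      ... | inj₁ a∈A         = member a∈A Na≡T*
      ... | inj₂ (inj₁ refl) = contradiction (trans (sym (proj₁ supported)) Na≡T*) λ ()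
      ... | inj₂ (inj₂ Na≡F) = contradiction (trans (sym Na≡F) Na≡T*) λ ()

      starred-aboveF* : ∀ {a} → a ∈ withValue T* → J a ≡ T* ⊎ J a ≡ T
      starred-aboveF* {a} a∈ = forceAboveF*-sound J a (holds (forceAboveF*∈ a∈))

      starred-T : ∀ {a b} → a ∈ withValue T* → b ∈ withValue T* → J b ≡ T → J a ≡ T
      starred-T {a} {b} a∈ b∈ = implication-sound J a b (holds (implication∈ a∈ b∈))

      starred-T* : ∀ {a} → a ∈ withValue T* → J a ≢ T → J a ≡ T*
      starred-T* a∈ Ja≢T with starred-aboveF* a∈
      ... | inj₁ Ja≡T* = Ja≡T*
      ... | inj₂ Ja≡T  = ⊥-elim (Ja≢T Ja≡T)

      determined-by-starred : (K : Interpretation) → (∀ {a} → N a ≢ T* → K a ≡ N a) →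
                              (∀ {a} → a ∈ withValue T* → J a ≡ K a) → J ≗ K
      determined-by-starred K K-off K-on a with N a ≟V T*
      ... | yes Na≡T* = K-on (starred Na≡T*)
      ... | no  Na≢T* = trans (pinned Na≢T*) (sym (K-off Na≢T*))

      -- The implications a ← b between starred atoms make them all T as soon as one of them is.
      encoding-minimal : J ≗ raise ∘ N ⊎ J ≗ N
      encoding-minimal with any? (λ b → J b ≟T) (withValue T*)
      ... | yes someT = let _ , b∈ , Jb≡T = find someT in
        inj₁ (determined-by-starred (raise ∘ N) raise-≢T*
          λ a∈ → trans (starred-T a∈ b∈ Jb≡T) (cong raise (sym (value a∈))))
      ... | no noT = inj₂ (determined-by-starred N (λ _ → refl)
          λ a∈ → trans (starred-T* a∈ (noT ∘ lose a∈)) (sym (value a∈)))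

  open Minimal using (encoding-minimal)

  solid-answerSet : ∀ {P N} → Supported A t N → Solid N → Model P N →
                    AnswerSet (P ++ encoding N) N
  solid-answerSet {P} {N} supported solid N⊨P =
    ++⁺ N⊨P (encoding-model N (proj₁ supported)) , solid , minimal
    where
      minimal : ∀ J → Model (P ++ encoding N) J → J ⪯ N → J ≗ N
      minimal J J⊨ J⪯
        with encoding-minimal N supported (++⁻ʳ P J⊨)
               (λ a → subst (J a ⪯V_) (sym (raise-≢T* (solid a))) (J⪯ a))
      ... | inj₁ J≗raiseN = λ a → trans (J≗raiseN a) (raise-≢T* (solid a))
      ... | inj₂ J≗N      = J≗N

  raise-answerSet : ∀ {P N} → Supported A t N → Model P (raise ∘ N) → ¬ Model P N →
                    AnswerSet (P ++ encoding N) (raise ∘ N)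
  raise-answerSet {P} {N} supported M⊨P N⊭P =
    ++⁺ M⊨P (Model-raise (encoding-model N (proj₁ supported))) , raise-solid ∘ N , minimal
    where
      minimal : ∀ J → Model (P ++ encoding N) J → J ⪯ (raise ∘ N) → J ≗ raise ∘ N
      minimal J J⊨ J⪯ with encoding-minimal N supported (++⁻ʳ P J⊨) J⪯
      ... | inj₁ J≗M = J≗M
      ... | inj₂ J≗N = ⊥-elim (N⊭P (Model-cong P (λ {a} _ → J≗N a) (++⁻ˡ P J⊨)))

fresh : List Atom → Atom
fresh as = suc (max 0 as)

fresh-∉ : ∀ as → fresh as ∉ as
fresh-∉ as fresh∈as = 1+n≰n (lookup (xs≤max 0 as) fresh∈as)

restrict : List Atom → Atom → Interpretation → Interpretation
restrict A t I a with a ∈? A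
... | yes _ = I a
... | no  _ with a ≟ℕ t
...   | yes _ = T
...   | no  _ = F

restrict-∈ : ∀ {A t I a} → a ∈ A → restrict A t I a ≡ I a
restrict-∈ {A} {a = a} a∈A with a ∈? A
... | yes _   = refl
... | no  a∉A = ⊥-elim (a∉A a∈A)

restrict-supported : ∀ {A t} I → t ∉ A → Supported A t (restrict A t I)
restrict-supported {A} {t} I t∉A = top , classify
  where
    top : restrict A t I t ≡ T
    top with t ∈? A
    ... | yes t∈A = ⊥-elim (t∉A t∈A)
    ... | no  _ with t ≟ℕ t
    ...   | yes _   = refl
    ...   | no  t≢t = ⊥-elim (t≢t refl)
    classify : ∀ a → a ∈ A ⊎ a ≡ t ⊎ restrict A t I a ≡ F
    classify a with a ∈? A
    ... | yes a∈A = inj₁ a∈A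
    ... | no  _ with a ≟ℕ t
    ...   | yes a≡t = inj₂ (inj₁ a≡t)
    ...   | no  _   = inj₂ (inj₂ refl)

StronglyEquivalent-sym : ∀ {P₁ P₂} → StronglyEquivalent P₁ P₂ → StronglyEquivalent P₂ P₁
StronglyEquivalent-sym se P I = proj₂ (se P I) , proj₁ (se P I)

LogicallyEquivalent-sym : ∀ {P₁ P₂} → LogicallyEquivalent P₁ P₂ → LogicallyEquivalent P₂ P₁
LogicallyEquivalent-sym le I = proj₂ (le I) , proj₁ (le I)

stronglyEquivalent⇒models⊆ : ∀ {P₁ P₂} → StronglyEquivalent P₁ P₂ →
                             ∀ {I} → Model P₁ I → Model P₂ I
stronglyEquivalent⇒models⊆ {P₁} {P₂} se {I} I⊨P₁ =
  Model-cong P₂ (restrict-∈ ∘ ∈-++⁺ʳ (atomsᴾ P₁)) N⊨P₂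
  where
    A = atomsᴾ P₁ ++ atomsᴾ P₂
    t = fresh A
    N = restrict A t I
    open Encoding A t

    supported : Supported A t N
    supported = restrict-supported I (fresh-∉ A)

    N⊨P₁ : Model P₁ N
    N⊨P₁ = Model-cong P₁ (sym ∘ restrict-∈ ∘ ∈-++⁺ˡ) I⊨P₁

    M⊨P₂ : Model P₂ (raise ∘ N)
    M⊨P₂ = ++⁻ˡ P₂ (proj₁ (proj₁ (se _ _)
      (solid-answerSet (Supported-raise supported) (raise-solid ∘ N) (Model-raise N⊨P₁))))

    N⊨P₂ : Model P₂ N
    N⊨P₂ with Model? P₂ N
    ... | yes N⊨ = N⊨
    ... | no  N⊭ = Model-cong P₂ (λ {a} _ → sym (N≗M a)) M⊨P₂
      where
        N≗M : N ≗ raise ∘ N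
        N≗M = proj₂ (proj₂ (proj₂ (se _ _) (raise-answerSet supported M⊨P₂ N⊭)))
                N (++⁺ N⊨P₁ (encoding-model N (proj₁ supported))) (⪯V-raise ∘ N)

answerSet-transfer : ∀ {P₁ P₂} → LogicallyEquivalent P₁ P₂ →
                     ∀ P I → AnswerSet (P₁ ++ P) I → AnswerSet (P₂ ++ P) I
answerSet-transfer le P I (I⊨ , solid , minimal) =
  Model-++ˡ P (proj₁ (le I)) I⊨ , solid ,
  λ J J⊨ → minimal J (Model-++ˡ P (proj₂ (le J)) J⊨)

logicallyEquivalent⇒stronglyEquivalent : ∀ {P₁ P₂} → LogicallyEquivalent P₁ P₂ →
                                         StronglyEquivalent P₁ P₂
logicallyEquivalent⇒stronglyEquivalent le P I =
  answerSet-transfer le P I , answerSet-transfer (LogicallyEquivalent-sym le) P I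

theorem2 : (P₁ P₂ : LPOD) →
    (StronglyEquivalent P₁ P₂ → LogicallyEquivalent P₁ P₂) × (LogicallyEquivalent P₁ P₂ → StronglyEquivalent P₁ P₂)
theorem2 P₁ P₂ =
  (λ se I → stronglyEquivalent⇒models⊆ se , stronglyEquivalent⇒models⊆ (StronglyEquivalent-sym se))
  , logicallyEquivalent⇒stronglyEquivalent
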